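{- Let $\mathfrak C[\mathcal F]$ be a full coset relation algebra and let $(x,y),(y,z)\in\mathcal E$. Then $(G_x\times G_y)\otimes(G_y\times G_z)=(G_x\times G_y)\,|\,(G_y\times G_z)=G_x\times G_z$.
   Context: Let $\langle G_x:x\in I\rangle$ be pairwise disjoint groups (operation $\circ$, identity $e_x$), $U=\bigcup_xG_x$, $\mathcal E$ an equivalence relation on $I$; for $(x,y)\in\mathcal E$ let $H_{xy}\trianglelefteq G_x$, $K_{xy}\trianglelefteq G_y$ and $\varphi_{xy}:G_x/H_{xy}\to G_y/K_{xy}$ an isomorphism; enumerate the cosets of $H_{xy}$ as $\langle H_{xy,\gamma}:\gamma<\kappa_{xy}\rangle$ without repetition with $H_{xy,0}=H_{xy}$, put $K_{xy,\gamma}=\varphi_{xy}(H_{xy,\gamma})$ and $R_{xy,\alpha}=\bigcup_{\gamma<\kappa_{xy}}H_{xy,\gamma}\times(K_{xy,\gamma}\circ K_{xy,\alpha})$. Let $A$ be the set of all unions of sets of such relations, with unit $\bigcup_{(x,y)\in\mathcal E}G_x\times G_y$; assume $A$ contains $\mathrm{id}_U$ and is closed under relational converse ${}^{ -1}$ and relational composition $|$. For $(x,y),(y,z)\in\mathcal E$ let $C_{xyz}$ be a coset of $H_{xy}\circ H_{xz}$ in $G_x$; define $R_{xy,\alpha}\otimes R_{yz,\beta}=\bigcup\{R_{xz,\gamma}:H_{xz,\gamma}\subseteq\varphi_{xy}^{ -1}[K_{xy,\alpha}\circ H_{yz,\beta}]\circ C_{xyz}\}$, $R_{xy,\alpha}\otimes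 R_{wz,\beta}=\varnothing$ for $y\ne w$, and extend distributively over arbitrary unions. When $\mathfrak C[\mathcal F]=(A,\cup,\sim,\otimes,{}^{ -1},\mathrm{id}_U)$ (complement relative to the unit) is a relation algebra, it is called a full coset relation algebra. -}

module Defs where

open import Level using (0ℓ)
open import Data.Product using (Σ; ∃; ∃₂; _×_; _,_)
open import Data.Sum using (_⊎_)
open import Relation.Nullary using (¬_)
open import Relation.Binary.PropositionalEquality using (_≡_)
open import Relation.Binary using (IsEquivalence)
open import Relation.Unary using (Pred; _⊆_; _≐_)
open import Algebra.Structures using (IsGroup)

module GroupSubsets {A : Set} (_·_ : A → A → A) (e : A) (inv : A → A) where

  _⊙_ : Pred A 0ℓ → Pred A 0ℓ → Pred A 0ℓ
  (X ⊙ Y) a = ∃₂ λ b c → X b × Y c × a ≡ b · c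

  record IsNormalSubgroup (N : Pred A 0ℓ) : Set where
    field
      e∈     : N e
      ·-closed : ∀ {a b} → N a → N b → N (a · b)
      inv-closed : ∀ {a} → N a → N (inv a)
      normal : ∀ g {n} → N n → N ((g · n) · inv g)

  IsCoset : Pred A 0ℓ → Pred A 0ℓ → Set
  IsCoset N X = Σ A λ g → X ≐ (λ a → Σ A λ n → N n × a ≡ g · n)

  record IsCosetEnumeration (N : Pred A 0ℓ) {Ix : Set} (c : Ix → Pred A 0ℓ) : Set₁ where
    field
      is-coset  : ∀ γ → IsCoset N (c γ)
      covers    : ∀ X → IsCoset N X → Σ Ix λ γ → X ≐ c γ
      no-repeat : ∀ γ δ → c γ ≐ c δ → γ ≡ δ

record CosetSystem : Set₁ where
  field
    I     : Set
    G     : I → Set                       -- the groups G_x (disjointness: U is a Σ-type)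
    op    : ∀ x → G x → G x → G x
    e     : ∀ x → G x
    inv   : ∀ x → G x → G x
    isGroup : ∀ x → IsGroup (_≡_ {A = G x}) (op x) (e x) (inv x)
    E     : I → I → Set
    E-equiv : IsEquivalence E
    H     : ∀ x y → Pred (G x) 0ℓ
    K     : ∀ x y → Pred (G y) 0ℓ
    H-normal : ∀ {x y} → E x y → GroupSubsets.IsNormalSubgroup (op x) (e x) (inv x) (H x y)
    K-normal : ∀ {x y} → E x y → GroupSubsets.IsNormalSubgroup (op y) (e y) (inv y) (K x y)
    -- index set κ_xy of the enumeration, with 0
    Cos   : I → I → Set
    zero  : ∀ x y → Cos x y
    Hc    : ∀ x y → Cos x y → Pred (G x) 0ℓ
    Hc-enum : ∀ {x y} → E x y → GroupSubsets.IsCosetEnumeration (op x) (e x) (inv x) (H x y) (Hc x y)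
    Hc-zero : ∀ {x y} → E x y → Hc x y (zero x y) ≐ H x y
    -- K_{xy,γ} = φ_xy(H_{xy,γ}), where φ_xy : G_x/H_xy → G_y/K_xy is an isomorphism:
    -- γ ↦ K_{xy,γ} is a bijection onto the cosets of K_xy preserving coset multiplication.
    Kc    : ∀ x y → Cos x y → Pred (G y) 0ℓ
    φ-bij : ∀ {x y} → E x y → GroupSubsets.IsCosetEnumeration (op y) (e y) (inv y) (K x y) (Kc x y)
    φ-hom : ∀ {x y} → E x y → ∀ γ δ ε →
              GroupSubsets._⊙_ (op x) (e x) (inv x) (Hc x y γ) (Hc x y δ) ≐ Hc x y ε →
              GroupSubsets._⊙_ (op y) (e y) (inv y) (Kc x y γ) (Kc x y δ) ≐ Kc x y ε
    C     : ∀ x y z → Pred (G x) 0ℓ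
    C-coset : ∀ {x y z} → E x y → E y z →
              GroupSubsets.IsCoset (op x) (e x) (inv x)
                (GroupSubsets._⊙_ (op x) (e x) (inv x) (H x y) (H x z)) (C x y z)

module CosetAlgebra (F : CosetSystem) where
  open CosetSystem F

  prod : ∀ x → Pred (G x) 0ℓ → Pred (G x) 0ℓ → Pred (G x) 0ℓ
  prod x = GroupSubsets._⊙_ (op x) (e x) (inv x)

  U : Set
  U = Σ I G

  InG : I → U → Set
  InG x u = Σ (G x) λ g → u ≡ (x , g)

  Rel : Set₁
  Rel = U → U → Set

  _⊆ᵣ_ : Rel → Rel → Set
  R ⊆ᵣ S = ∀ u v → R u v → S u v

  _≐ᵣ_ : Rel → Rel → Set
  R ≐ᵣ S = (R ⊆ᵣ S) × (S ⊆ᵣ R)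

  Full : I → I → Rel
  Full x y u v = InG x u × InG y v

  R : ∀ x y → Cos x y → Rel
  R x y α u v = ∃ λ γ → ∃₂ λ (g : G x) (g' : G y) →
                  u ≡ (x , g) × v ≡ (y , g') × Hc x y γ g × prod y (Kc x y γ) (Kc x y α) g'

  -- φ_xy⁻¹[S] for S ⊆ G_y a union of K_xy-cosets: the union of the H_{xy,δ}
  -- with φ_xy(H_{xy,δ}) = K_{xy,δ} ⊆ S
  φ⁻¹[_] : ∀ {x y} → Pred (G y) 0ℓ → Pred (G x) 0ℓ
  φ⁻¹[_] {x} {y} S g = Σ (Cos x y) λ δ → Kc x y δ ⊆ S × Hc x y δ g

  basic⊗ : ∀ x y z → Cos x y → Cos y z → Rel
  basic⊗ x y z α β u v =
    Σ (Cos x z) λ γ →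
      (Hc x z γ ⊆ prod x (φ⁻¹[_] {x} {y} (prod y (Kc x y α) (Hc y z β))) (C x y z))
      × R x z γ u v

  -- ⊗ extended distributively (R_{xy,α} ⊗ R_{wz,β} = ∅ for y ≠ w)
  _⊗_ : Rel → Rel → Rel
  (P ⊗ Q) u v = ∃ λ x → ∃ λ y → ∃ λ z → ∃ λ (α : Cos x y) → ∃ λ (β : Cos y z) →
                 E x y × E y z × R x y α ⊆ᵣ P × R y z β ⊆ᵣ Q × basic⊗ x y z α β u v

  𝟙 : Rel
  𝟙 u v = ∃₂ λ x y → E x y × Full x y u v

  _∪_ : Rel → Rel → Rel
  (P ∪ Q) u v = P u v ⊎ Q u v

  ∼_ : Rel → Rel
  (∼ P) u v = 𝟙 u v × ¬ P u v

  _⁻¹ : Rel → Rel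
  (P ⁻¹) u v = P v u

  _∣_ : Rel → Rel → Rel
  (P ∣ Q) u v = ∃ λ w → P u w × Q w v

  idU : Rel
  idU u v = u ≡ v

  A : Rel → Set₁
  A P = Σ (∀ x y → Cos x y → Set) λ S →
          P ≐ᵣ (λ u v → ∃ λ x → ∃ λ y → ∃ λ (α : Cos x y) → E x y × S x y α × R x y α u v)

  -- (A, ∪, ∼, ⊗, ⁻¹, id_U) is a relation algebra (Tarski's axioms R1–R10),
  -- equality of elements being equality of relations as sets of pairs.
  record IsRelationAlgebra : Set₁ where
    field
      ∪-closed : ∀ {a b} → A a → A b → A (a ∪ b)
      ∼-closed : ∀ {a} → A a → A (∼ a)
      ⊗-closed : ∀ {a b} → A a → A b → A (a ⊗ b)
      ⁻¹-closed : ∀ {a} → A a → A (a ⁻¹)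
      id-closed : A idU
      R1 : ∀ {a b} → A a → A b → (a ∪ b) ≐ᵣ (b ∪ a)
      R2 : ∀ {a b c} → A a → A b → A c → (a ∪ (b ∪ c)) ≐ᵣ ((a ∪ b) ∪ c)
      R3 : ∀ {a b} → A a → A b → ((∼ ((∼ a) ∪ b)) ∪ (∼ ((∼ a) ∪ (∼ b)))) ≐ᵣ a
      R4 : ∀ {a b c} → A a → A b → A c → (a ⊗ (b ⊗ c)) ≐ᵣ ((a ⊗ b) ⊗ c)
      R5 : ∀ {a b c} → A a → A b → A c → ((a ∪ b) ⊗ c) ≐ᵣ ((a ⊗ c) ∪ (b ⊗ c))
      R6 : ∀ {a} → A a → (a ⊗ idU) ≐ᵣ a
      R7 : ∀ {a} → A a → ((a ⁻¹) ⁻¹) ≐ᵣ a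
      R8 : ∀ {a b} → A a → A b → ((a ∪ b) ⁻¹) ≐ᵣ ((a ⁻¹) ∪ (b ⁻¹))
      R9 : ∀ {a b} → A a → A b → ((a ⊗ b) ⁻¹) ≐ᵣ ((b ⁻¹) ⊗ (a ⁻¹))
      R10 : ∀ {a b} → A a → A b → (((a ⁻¹) ⊗ (∼ (a ⊗ b))) ∪ (∼ b)) ≐ᵣ (∼ b)

  record IsFullCosetRelationAlgebra : Set₁ where
    field
      A-id   : A idU
      A-conv : ∀ {a} → A a → A (a ⁻¹)
      A-comp : ∀ {a b} → A a → A b → A (a ∣ b)
      isRA   : IsRelationAlgebra

{-# OPTIONS --safe #-}
module Submission where

open import Level using (0ℓ)
open import Data.Product using (Σ; ∃; _×_; _,_; proj₁; proj₂)
open import Function using (id)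
open import Relation.Binary.PropositionalEquality using (_≡_; refl; sym; cong; module ≡-Reasoning)
open import Relation.Binary using (IsEquivalence)
open import Relation.Unary using (Pred; _⊆_)
open import Algebra.Structures using (IsGroup)
open import Algebra.Bundles using (Group)
import Algebra.Properties.Group as GroupProperties

open import Defs

-- Since every R_{xy,α} is nonempty, R_{xy,α} ⊆ G_x' × G_y' forces (x , y) = (x' , y'),
-- which gives ⊆.  Conversely, every (g , h) ∈ G_x × G_z lies in some R_{xz,γ}: take
-- g ∈ H_{xz,γ₁}, any m ∈ K_{xz,γ₁}, and γ with m⁻¹ h ∈ K_{xz,γ}.  With β = 0 the side
-- condition of ⊗ asks for H_{xz,γ} = g₂ H_xz ⊆ φ⁻¹[K_{xy,α} ∘ H_yz] ∘ C_xyz, which holds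
-- for the α with g₂ c⁻¹ ∈ H_{xy,α}, where C_xyz = c (H_xy ∘ H_xz), as g₂ n = (g₂ c⁻¹)(c n).

module CosetProperties {A : Set} {_·_ : A → A → A} {e : A} {inv : A → A}
                       (isGroup : IsGroup _≡_ _·_ e inv) where

  open GroupSubsets _·_ e inv
  open IsGroup isGroup using (assoc; identityˡ; identityʳ)

  group : Group 0ℓ 0ℓ
  group = record { isGroup = isGroup }

  open GroupProperties group public using (\\-leftDividesˡ; \\-leftDividesʳ)

  leftCoset : Pred A 0ℓ → A → Pred A 0ℓ
  leftCoset N g a = Σ A λ n → N n × a ≡ g · n

  ∈-leftCoset : ∀ {N} g → N e → leftCoset N g g
  ∈-leftCoset g e∈N = e , e∈N , sym (identityʳ g)

  coset-inhabited : ∀ {N X} → N e → IsCoset N X → Σ A X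
  coset-inhabited e∈N (g , _ , gN⊆X) = g , gN⊆X (∈-leftCoset g e∈N)

  ⊙-identityʳ-⊇ : ∀ {X N} → N e → X ⊆ X ⊙ N
  ⊙-identityʳ-⊇ e∈N {a} a∈X = a , e , a∈X , e∈N , sym (identityʳ a)

  module _ {N : Pred A 0ℓ} {Ix : Set} {c : Ix → Pred A 0ℓ}
           (enum : IsCosetEnumeration N c) (e∈N : N e) where

    open IsCosetEnumeration enum using (covers)

    cosetOf : A → Ix
    cosetOf g = proj₁ (covers (leftCoset N g) (g , id , id))

    ∈-cosetOf : ∀ g → c (cosetOf g) g
    ∈-cosetOf g = proj₁ (proj₂ (covers (leftCoset N g) (g , id , id))) (∈-leftCoset g e∈N)

  leftCoset-⊆-⊙ : ∀ {M N P Q : Pred A 0ℓ} g c → M e →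
                  P (g · inv c) → leftCoset (M ⊙ N) c ⊆ Q → leftCoset N g ⊆ P ⊙ Q
  leftCoset-⊆-⊙ {M} {N} g c e∈M gc⁻¹∈P cMN⊆Q (n , n∈N , refl) =
    g · inv c , c · n , gc⁻¹∈P , cMN⊆Q cn∈cMN , g·n≡gc⁻¹·cn
    where
    cn∈cMN : leftCoset (M ⊙ N) c (c · n)
    cn∈cMN = n , (e , n , e∈M , n∈N , sym (identityˡ n)) , refl

    g·n≡gc⁻¹·cn : g · n ≡ (g · inv c) · (c · n)
    g·n≡gc⁻¹·cn = sym (begin
      (g · inv c) · (c · n)  ≡⟨ assoc g (inv c) (c · n) ⟩
      g · (inv c · (c · n))  ≡⟨ cong (g ·_) (\\-leftDividesʳ c n) ⟩
      g · n                  ∎)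
      where open ≡-Reasoning

module FullRelations (F : CosetSystem) where

  open CosetSystem F
  open CosetAlgebra F

  private
    module Coset x = CosetProperties (isGroup x)
    module HNormal {x y} (p : E x y) = GroupSubsets.IsNormalSubgroup (H-normal p)
    module KNormal {x y} (p : E x y) = GroupSubsets.IsNormalSubgroup (K-normal p)
    module HEnum {x y} (p : E x y) = GroupSubsets.IsCosetEnumeration (Hc-enum p)
    module KEnum {x y} (p : E x y) = GroupSubsets.IsCosetEnumeration (φ-bij p)

    E-trans : ∀ {x y z} → E x y → E y z → E x z
    E-trans = IsEquivalence.trans E-equiv

  Hcoset : ∀ {x y} → E x y → G x → Cos x y
  Hcoset {x} p = Coset.cosetOf x (Hc-enum p) (HNormal.e∈ p)

  ∈-Hcoset : ∀ {x y} (p : E x y) g → Hc x y (Hcoset p g) g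
  ∈-Hcoset {x} p = Coset.∈-cosetOf x (Hc-enum p) (HNormal.e∈ p)

  Kcoset : ∀ {x y} → E x y → G y → Cos x y
  Kcoset {y = y} p = Coset.cosetOf y (φ-bij p) (KNormal.e∈ p)

  ∈-Kcoset : ∀ {x y} (p : E x y) k → Kc x y (Kcoset p k) k
  ∈-Kcoset {y = y} p = Coset.∈-cosetOf y (φ-bij p) (KNormal.e∈ p)

  Kc-inhabited : ∀ {x y} → E x y → ∀ α → Σ (G y) (Kc x y α)
  Kc-inhabited {y = y} p α =
    Coset.coset-inhabited y (KNormal.e∈ p) (KEnum.is-coset p α)

  InG-index : ∀ {x x'} {g : G x} → InG x' (x , g) → x ≡ x'
  InG-index (_ , p) = cong proj₁ p

  R⊆Full : ∀ {x y} {α : Cos x y} → R x y α ⊆ᵣ Full x y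
  R⊆Full _ _ (_ , g , h , refl , refl , _) = (g , refl) , (h , refl)

  -- K_{xy,0} need not visibly contain e_y, so the witness uses some k₀ ∈ K_{xy,0}.
  R-inhabited : ∀ {x y} → E x y → ∀ α → Σ (G y) λ k → R x y α (x , e x) (y , k)
  R-inhabited {x} {y} p α with Kc-inhabited p (zero x y) | Kc-inhabited p α
  ... | k₀ , k₀∈ | k , k∈ =
    op y k₀ k , zero x y , e x , op y k₀ k , refl , refl ,
    proj₂ (Hc-zero p) (HNormal.e∈ p) , (k₀ , k , k₀∈ , k∈ , refl)

  R⊆Full⇒index≡ : ∀ {x y x' y'} {α : Cos x y} → E x y → R x y α ⊆ᵣ Full x' y' →
                  x ≡ x' × y ≡ y'
  R⊆Full⇒index≡ p Rα⊆ with Rα⊆ _ _ (proj₂ (R-inhabited p _))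
  ... | u∈ , v∈ = InG-index u∈ , InG-index v∈

  Full⊆⋃R : ∀ {x y} → E x y → Full x y ⊆ᵣ (λ u v → ∃ λ γ → R x y γ u v)
  Full⊆⋃R {x} {y} p _ _ ((g , refl) , (h , refl)) =
    Kcoset p t , Hcoset p g , g , h , refl , refl , ∈-Hcoset p g ,
    (m , t , m∈ , ∈-Kcoset p t , sym (Coset.\\-leftDividesˡ y m h))
    where
    m : G y
    m = proj₁ (Kc-inhabited p (Hcoset p g))
    m∈ : Kc x y (Hcoset p g) m
    m∈ = proj₂ (Kc-inhabited p (Hcoset p g))

    t : G y
    t = op y (inv y m) h

  Hc⊆φ⁻¹[Kc⊙H] : ∀ {x y z} {α : Cos x y} → E y z →
                 Hc x y α ⊆ φ⁻¹[_] {x} {y} (prod y (Kc x y α) (Hc y z (zero y z)))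
  Hc⊆φ⁻¹[Kc⊙H] {y = y} {α = α} q g∈ =
    α , Coset.⊙-identityʳ-⊇ y (proj₂ (Hc-zero q) (HNormal.e∈ q)) , g∈

  Hc⊆⊗-condition : ∀ {x y z} → E x y → E y z → ∀ γ → ∃ λ α →
                   Hc x z γ ⊆ prod x (φ⁻¹[_] {x} {y} (prod y (Kc x y α) (Hc y z (zero y z))))
                                     (C x y z)
  Hc⊆⊗-condition {x} {y} {z} p q γ =
    α , λ a∈ → Coset.leftCoset-⊆-⊙ x g c (HNormal.e∈ p)
                 (Hc⊆φ⁻¹[Kc⊙H] q (∈-Hcoset p (op x g (inv x c))))
                 (proj₂ (proj₂ (C-coset p q)))
                 (proj₁ (proj₂ (HEnum.is-coset (E-trans p q) γ)) a∈)
    where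
    g c : G x
    g = proj₁ (HEnum.is-coset (E-trans p q) γ)
    c = proj₁ (C-coset p q)

    α : Cos x y
    α = Hcoset p (op x g (inv x c))

  ⊗-Full-⊆ : ∀ {x y z} → (Full x y ⊗ Full y z) ⊆ᵣ Full x z
  ⊗-Full-⊆ u v (_ , _ , _ , _ , _ , p , q , Rα⊆ , Rβ⊆ , _ , _ , u~v)
    with R⊆Full⇒index≡ p Rα⊆ | R⊆Full⇒index≡ q Rβ⊆
  ... | refl , _ | _ , refl = R⊆Full u v u~v

  Full-⊆-⊗ : ∀ {x y z} → E x y → E y z → Full x z ⊆ᵣ (Full x y ⊗ Full y z)
  Full-⊆-⊗ {x} {y} {z} p q u v uv with Full⊆⋃R (E-trans p q) u v uv
  ... | γ , u~v with Hc⊆⊗-condition p q γ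
  ... | α , cond = x , y , z , α , zero y z , p , q , R⊆Full , R⊆Full , γ , cond , u~v

  ∣-Full-⊆ : ∀ {x y z} → (Full x y ∣ Full y z) ⊆ᵣ Full x z
  ∣-Full-⊆ _ _ (_ , (u∈ , _) , (_ , v∈)) = u∈ , v∈

  Full-⊆-∣ : ∀ {x y z} → Full x z ⊆ᵣ (Full x y ∣ Full y z)
  Full-⊆-∣ {y = y} _ _ (u∈ , v∈) = (y , e y) , (u∈ , (e y , refl)) , ((e y , refl) , v∈)

lemma2p13 : (F : CosetSystem) → CosetAlgebra.IsFullCosetRelationAlgebra F →
    ∀ {x y z} → CosetSystem.E F x y → CosetSystem.E F y z →
    let open CosetAlgebra F in
    ((Full x y ⊗ Full y z) ≐ᵣ Full x z) × ((Full x y ∣ Full y z) ≐ᵣ Full x z)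
lemma2p13 F _ p q = (⊗-Full-⊆ , Full-⊆-⊗ p q) , (∣-Full-⊆ , Full-⊆-∣)
  where open FullRelations F
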